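{- For every $n\ge 3$, the cycle $C_n$ on $n$ vertices satisfies $\sigma^-(C_n)=2$.
   Context: For a simple graph $G$ with $n$ vertices and a bijection $f:V(G)\to\{1,\dots,n\}$, the parity signed graph $G_f$ is $G$ with each edge $uv$ given sign $+$ if $f(u),f(v)$ have the same parity and $-$ otherwise. The `rna' number $\sigma^-(G)$ is the minimum, over all such bijections $f$, of the number of negative edges of $G_f$. -}

module Defs where

open import Data.Nat using (ℕ; zero; suc; _<_; _≤_; _%_; _+_)
open import Data.Nat.Properties using (_<?_)
open import Data.Bool using (Bool; true; false; not; T)
open import Data.Fin using (Fin; toℕ)
open import Data.List using (List; []; _∷_; length; filter; allFin; concatMap; map)
open import Data.Product using (_×_; _,_)
open import Relation.Nullary using (Dec; ¬_; ¬?)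
open import Relation.Nullary.Decidable using (_×-dec_)
open import Relation.Binary.PropositionalEquality using (_≡_)
open import Function.Bundles using (_⤖_)
import Data.Bool.Properties as B

-- A finite simple graph on vertex set Fin n: decidable (Bool-valued),
-- irreflexive, symmetric adjacency.
-- (Only the adjacency is recorded; edges are read off from pairs u < v,
-- so the graph is simple by construction.  Symmetry is assumed of Adj.)
record SimpleGraph (n : ℕ) : Set where
  constructor graph
  field
    Adj    : Fin n → Fin n → Bool
open SimpleGraph public

-- Each edge {u,v} listed once, as the ordered pair (u , v) with toℕ u < toℕ v.
edges : ∀ {n} → SimpleGraph n → List (Fin n × Fin n)
edges {n} G = filter isEdge (concatMap (λ i → map (λ j → (i , j)) (allFin n)) (allFin n))
  where
  isEdge : (p : Fin n × Fin n) → Dec (toℕ (Data.Product.proj₁ p) < toℕ (Data.Product.proj₂ p) × T (Adj G (Data.Product.proj₁ p) (Data.Product.proj₂ p)))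
  isEdge (i , j) = (toℕ i <? toℕ j) ×-dec Data.Bool.T? (Adj G i j)

even? : ℕ → Bool
even? zero = true
even? (suc m) = not (even? m)

-- A bijection f : V(G) → {1,…,n}; vertex v gets label toℕ (f v) + 1.
label : ∀ {n} → (Fin n ⤖ Fin n) → Fin n → ℕ
label f v = suc (toℕ (Function.Bundles.Bijection.to f v))

negativeEdges : ∀ {n} → SimpleGraph n → (Fin n ⤖ Fin n) → ℕ
negativeEdges {n} G f = length (filter isNeg (edges G))
  where
  isNeg : (p : Fin n × Fin n) → Dec (¬ (even? (label f (Data.Product.proj₁ p)) ≡ even? (label f (Data.Product.proj₂ p))))
  isNeg (u , v) = ¬? (even? (label f u) B.≟ even? (label f v))

-- σ⁻(G) = k : k is the minimum over bijections f of the number of negative edges.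
IsRna : ∀ {n} → SimpleGraph n → ℕ → Set
IsRna {n} G k = (Data.Product.∃ λ (f : Fin n ⤖ Fin n) → negativeEdges G f ≡ k)
              × (∀ (f : Fin n ⤖ Fin n) → k ≤ negativeEdges G f)

next : (n : ℕ) → Fin n → Fin n → Bool
next zero a b = false
next (suc m) a b = Relation.Nullary.Decidable.⌊ toℕ b Data.Nat.Properties.≟ (suc (toℕ a) % suc m) ⌋

-- The cycle C_n: i ~ j iff j ≡ i+1 (mod n) or i ≡ j+1 (mod n).
-- (For n ≥ 3 this is the simple cycle 0 - 1 - … - (n-1) - 0.)
cycleAdj : (n : ℕ) → Fin n → Fin n → Bool
cycleAdj n i j = Data.Bool._∨_ (next n i j) (next n j i)

C : (n : ℕ) → SimpleGraph n
C n = graph (cycleAdj n)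

module Submission where

-- Lower bound: labels 1 and 2 both occur, so the parity of the labels, read around the cycle, is not
-- constant. A non-constant cyclic Boolean sequence changes value at least twice (on the way from vertex 0
-- to a vertex of the other parity, and on the way back), and every change is a negative edge.
-- Upper bound: with c = ⌈n/2⌉, give the vertices 0, …, c-1 the odd labels 1, 3, 5, … in order and the
-- remaining vertices the even labels 2, 4, …; then only the edges {c-1, c} and {0, n-1} are negative.

open import Defs
open import Data.Nat using (ℕ; zero; suc; _+_; _∸_; _<_; _≤_; _≥_; z≤n; s≤s; _%_; ⌊_/2⌋)
open import Data.Nat.Properties
open import Data.Nat.DivMod using (_mod_; m<n⇒m%n≡m; n%n≡0)
open import Data.Bool using (Bool; true; false; not; T; T?)
open import Data.Bool.Properties using (not-involutive; T-∨)
import Data.Bool.Properties as Bool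
open import Data.Fin using (Fin; toℕ; fromℕ<) renaming (zero to fzero; suc to fsuc)
open import Data.Fin.Properties using (toℕ-injective; toℕ-fromℕ<; toℕ<n)
open import Data.List using (List; []; _∷_; length; filter; allFin; concatMap; map; cartesianProduct; _++_)
open import Data.List.Membership.Propositional using (_∈_)
open import Data.List.Membership.Propositional.Properties using (∈-filter⁺; ∈-filter⁻; ∈-cartesianProduct⁺; ∈-allFin; ∈-length)
open import Data.List.Relation.Unary.Unique.Propositional using (Unique)
import Data.List.Relation.Unary.Unique.Propositional.Properties as Unique
open import Data.List.Relation.Unary.Any using (here; there)
open import Data.List.Relation.Unary.All as All using (All; _∷_)
open import Data.List.Relation.Unary.AllPairs using (_∷_)
open import Data.Product using (∃; ∃₂; _×_; _,_; proj₁; proj₂)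
open import Data.Sum using (_⊎_; inj₁; inj₂)
open import Data.Empty using (⊥; ⊥-elim)
open import Relation.Nullary using (¬_; Dec; yes; no; ¬?)
open import Relation.Nullary.Decidable using (_×-dec_; fromWitness; toWitness)
open import Relation.Binary.PropositionalEquality
open import Algebra.Properties.CommutativeSemigroup +-commutativeSemigroup using (interchange)
open import Function.Base using (_∘_)
open import Function.Consequences.Propositional using (strictlySurjective⇒surjective)
open import Function.Bundles using (_⤖_; _⇔_; Bijection; Equivalence; mk⤖)

private
  variable
    A B : Set
    n : ℕ

concatMap-pairs≡cartesianProduct : (xs : List A) (ys : List B) →
  concatMap (λ i → map (λ j → (i , j)) ys) xs ≡ cartesianProduct xs ys
concatMap-pairs≡cartesianProduct []       ys = refl
concatMap-pairs≡cartesianProduct (x ∷ xs) ys = cong (map (x ,_) ys ++_) (concatMap-pairs≡cartesianProduct xs ys)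

OppositeParity : (Fin n ⤖ Fin n) → Fin n → Fin n → Set
OppositeParity f u v = ¬ even? (label f u) ≡ even? (label f v)

negativeEdgeList : SimpleGraph n → (Fin n ⤖ Fin n) → List (Fin n × Fin n)
negativeEdgeList G f = filter (λ (u , v) → ¬? (even? (label f u) Bool.≟ even? (label f v))) (edges G)

module _ (G : SimpleGraph n) where

  private
    isEdge? : (p : Fin n × Fin n) → Dec (toℕ (proj₁ p) < toℕ (proj₂ p) × T (Adj G (proj₁ p) (proj₂ p)))
    isEdge? (u , v) = (toℕ u <? toℕ v) ×-dec T? (Adj G u v)

    allPairs : List (Fin n × Fin n)
    allPairs = concatMap (λ i → map (λ j → (i , j)) (allFin n)) (allFin n)

    allPairs≡ : allPairs ≡ cartesianProduct (allFin n) (allFin n)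
    allPairs≡ = concatMap-pairs≡cartesianProduct (allFin n) (allFin n)

  ∈-edges⁺ : ∀ {u v} → toℕ u < toℕ v → T (Adj G u v) → (u , v) ∈ edges G
  ∈-edges⁺ {u} {v} u<v adj =
    ∈-filter⁺ isEdge? (subst ((u , v) ∈_) (sym allPairs≡) (∈-cartesianProduct⁺ (∈-allFin u) (∈-allFin v))) (u<v , adj)

  ∈-edges⁻ : ∀ {u v} → (u , v) ∈ edges G → toℕ u < toℕ v × T (Adj G u v)
  ∈-edges⁻ e = proj₂ (∈-filter⁻ isEdge? {xs = allPairs} e)

  edges-unique : Unique (edges G)
  edges-unique = Unique.filter⁺ isEdge? (subst Unique (sym allPairs≡) (Unique.cartesianProduct⁺ (Unique.allFin⁺ n) (Unique.allFin⁺ n)))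

  module _ (f : Fin n ⤖ Fin n) where

    private
      opposite? : (p : Fin n × Fin n) → Dec (OppositeParity f (proj₁ p) (proj₂ p))
      opposite? (u , v) = ¬? (even? (label f u) Bool.≟ even? (label f v))

    ∈-negativeEdgeList⁺ : ∀ {u v} → (u , v) ∈ edges G → OppositeParity f u v → (u , v) ∈ negativeEdgeList G f
    ∈-negativeEdgeList⁺ = ∈-filter⁺ opposite?

    ∈-negativeEdgeList⁻ : ∀ {u v} → (u , v) ∈ negativeEdgeList G f → (u , v) ∈ edges G × OppositeParity f u v
    ∈-negativeEdgeList⁻ = ∈-filter⁻ opposite? {xs = edges G}

    negativeEdgeList-unique : Unique (negativeEdgeList G f)
    negativeEdgeList-unique = Unique.filter⁺ opposite? edges-unique

Ends : ℕ → ℕ → Fin n × Fin n → Set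
Ends a b (u , v) = toℕ u ≡ a × toℕ v ≡ b

Ends-unique : ∀ {a b} {e e′ : Fin n × Fin n} → Ends a b e → Ends a b e′ → e ≡ e′
Ends-unique (u≡a , v≡b) (u′≡a , v′≡b) = cong₂ _,_ (toℕ-injective (trans u≡a (sym u′≡a))) (toℕ-injective (trans v≡b (sym v′≡b)))

2≤length : ∀ {x y : A} {xs} → x ∈ xs → y ∈ xs → x ≢ y → 2 ≤ length xs
2≤length (here refl) (here refl) x≢y = ⊥-elim (x≢y refl)
2≤length (here refl) (there y∈) _    = s≤s (∈-length y∈)
2≤length (there x∈)  (here refl) _   = s≤s (∈-length x∈)
2≤length (there x∈)  (there y∈) x≢y  = m≤n⇒m≤1+n (2≤length x∈ y∈ x≢y)

length≤2 : {P Q : A → Set} → (∀ {x y} → P x → P y → x ≡ y) → (∀ {x y} → Q x → Q y → x ≡ y) →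
           ∀ {xs} → Unique xs → All (λ x → P x ⊎ Q x) xs → length xs ≤ 2
length≤2 _ _ {[]}                _ _ = z≤n
length≤2 _ _ {_ ∷ []}            _ _ = s≤s z≤n
length≤2 _ _ {_ ∷ _ ∷ []}        _ _ = s≤s (s≤s z≤n)
length≤2 {P = P} {Q} P-unique Q-unique {x ∷ y ∷ z ∷ _} ((x≢y ∷ x≢z ∷ _) ∷ (y≢z ∷ _) ∷ _) (px ∷ py ∷ pz ∷ _) =
  ⊥-elim (pigeonhole px py pz)
  where
  pigeonhole : P x ⊎ Q x → P y ⊎ Q y → P z ⊎ Q z → ⊥
  pigeonhole (inj₁ a) (inj₁ b) _        = x≢y (P-unique a b)
  pigeonhole (inj₂ a) (inj₂ b) _        = x≢y (Q-unique a b)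
  pigeonhole (inj₁ a) _        (inj₁ c) = x≢z (P-unique a c)
  pigeonhole (inj₂ a) _        (inj₂ c) = x≢z (Q-unique a c)
  pigeonhole _        (inj₁ b) (inj₁ c) = y≢z (P-unique b c)
  pigeonhole _        (inj₂ b) (inj₂ c) = y≢z (Q-unique b c)

module _ {m : ℕ} where

  next⇒≡ : ∀ {a b : Fin (suc m)} → T (next (suc m) a b) → toℕ b ≡ suc (toℕ a) % suc m
  next⇒≡ {a} {b} = toWitness {a? = toℕ b ≟ suc (toℕ a) % suc m}

  ≡⇒next : ∀ {a b : Fin (suc m)} → toℕ b ≡ suc (toℕ a) % suc m → T (next (suc m) a b)
  ≡⇒next {a} {b} = fromWitness {a? = toℕ b ≟ suc (toℕ a) % suc m}

  T-cycleAdj : ∀ {a b : Fin (suc m)} → T (cycleAdj (suc m) a b) ⇔ (T (next (suc m) a b) ⊎ T (next (suc m) b a))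
  T-cycleAdj {a} {b} = T-∨ {next (suc m) a b} {next (suc m) b a}

module _ {m : ℕ} {u v : Fin (suc m)} where

  cycleAdj-step : toℕ v ≡ suc (toℕ u) → T (cycleAdj (suc m) u v)
  cycleAdj-step v≡1+u = Equivalence.from T-cycleAdj (inj₁ (≡⇒next (trans v≡1+u (sym 1+u%n≡1+u))))
    where
    1+u%n≡1+u : suc (toℕ u) % suc m ≡ suc (toℕ u)
    1+u%n≡1+u = m<n⇒m%n≡m (subst (_< suc m) v≡1+u (toℕ<n v))

  cycleAdj-wrap : toℕ u ≡ 0 → suc (toℕ v) ≡ suc m → T (cycleAdj (suc m) u v)
  cycleAdj-wrap u≡0 1+v≡n = Equivalence.from T-cycleAdj (inj₂ (≡⇒next (trans u≡0 (sym 1+v%n≡0))))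
    where
    1+v%n≡0 : suc (toℕ v) % suc m ≡ 0
    1+v%n≡0 = trans (cong (_% suc m) 1+v≡n) (n%n≡0 (suc m))

  cycleAdj⇒step⊎wrap : toℕ u < toℕ v → T (cycleAdj (suc m) u v) →
                       toℕ v ≡ suc (toℕ u) ⊎ (toℕ u ≡ 0 × suc (toℕ v) ≡ suc m)
  cycleAdj⇒step⊎wrap u<v adj with Equivalence.to T-cycleAdj adj
  ... | inj₁ next-uv = inj₁ (trans (next⇒≡ next-uv) (m<n⇒m%n≡m (≤-<-trans u<v (toℕ<n v))))
  ... | inj₂ next-vu with suc (toℕ v) ≟ suc m
  ...   | yes 1+v≡n = inj₂ (trans (next⇒≡ next-vu) (trans (cong (_% suc m) 1+v≡n) (n%n≡0 (suc m))) , 1+v≡n)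
  ...   | no 1+v≢n  = ⊥-elim (<-asym u<v (subst (toℕ v <_) (sym u≡1+v) ≤-refl))
    where
    u≡1+v : toℕ u ≡ suc (toℕ v)
    u≡1+v = trans (next⇒≡ next-vu) (m<n⇒m%n≡m (≤∧≢⇒< (toℕ<n v) 1+v≢n))

module _ {m : ℕ} {u v : Fin (suc m)} where

  ∈-C-step : toℕ v ≡ suc (toℕ u) → (u , v) ∈ edges (C (suc m))
  ∈-C-step v≡1+u = ∈-edges⁺ (C (suc m)) (subst (toℕ u <_) (sym v≡1+u) ≤-refl) (cycleAdj-step v≡1+u)

  ∈-C-wrap : toℕ u < toℕ v → toℕ u ≡ 0 → suc (toℕ v) ≡ suc m → (u , v) ∈ edges (C (suc m))
  ∈-C-wrap u<v u≡0 1+v≡n = ∈-edges⁺ (C (suc m)) u<v (cycleAdj-wrap u≡0 1+v≡n)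

  ∈-C⁻ : (u , v) ∈ edges (C (suc m)) → toℕ v ≡ suc (toℕ u) ⊎ (toℕ u ≡ 0 × suc (toℕ v) ≡ suc m)
  ∈-C⁻ e = let u<v , adj = ∈-edges⁻ (C (suc m)) e in cycleAdj⇒step⊎wrap u<v adj

Change : (ℕ → Bool) → ℕ → Set
Change q i = q i ≢ q (suc i)

change-between : (q : ℕ → Bool) {a b : ℕ} → a < b → q a ≢ q b → ∃ λ i → a ≤ i × i < b × Change q i
change-between q {a} {suc b} a<1+b qa≢q1+b with q b Bool.≟ q (suc b)
... | no change = b , ≤-pred a<1+b , ≤-refl , change
... | yes qb≡q1+b with a ≟ b
...   | yes refl = ⊥-elim (qa≢q1+b qb≡q1+b)
...   | no a≢b   =
  let i , a≤i , i<b , change = change-between q (≤∧≢⇒< (≤-pred a<1+b) a≢b) (λ qa≡qb → qa≢q1+b (trans qa≡qb qb≡q1+b))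
  in  i , a≤i , m≤n⇒m≤1+n i<b , change

two-changes : (q : ℕ → Bool) {k n : ℕ} → k < n → q k ≢ q 0 → q n ≡ q 0 →
              ∃₂ λ i j → i < k × k ≤ j × j < n × Change q i × Change q j
two-changes q {k} k<n qk≢q0 qn≡q0 =
  let i , _   , i<k , changeᵢ = change-between q 0<k (λ q0≡qk → qk≢q0 (sym q0≡qk))
      j , k≤j , j<n , changeⱼ = change-between q k<n (λ qk≡qn → qk≢q0 (trans qk≡qn qn≡q0))
  in  i , j , i<k , k≤j , j<n , changeᵢ , changeⱼ
  where
  0<k : 0 < k
  0<k = n≢0⇒n>0 (λ k≡0 → qk≢q0 (cong q k≡0))

module LowerBound (m : ℕ) (f : Fin (3 + m) ⤖ Fin (3 + m)) where

  private
    N : ℕ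
    N = 3 + m

  parity : ℕ → Bool
  parity j = even? (label f (j mod N))

  toℕ-mod : ∀ {j} → j < N → toℕ (j mod N) ≡ j
  toℕ-mod j<N = trans (toℕ-fromℕ< _) (m<n⇒m%n≡m j<N)

  parity-toℕ : ∀ w → parity (toℕ w) ≡ even? (label f w)
  parity-toℕ w = cong (even? ∘ label f) (toℕ-injective (toℕ-mod (toℕ<n w)))

  parity-N : parity N ≡ parity 0
  parity-N = cong (even? ∘ label f) (toℕ-injective (trans (toℕ-fromℕ< _) (n%n≡0 N)))

  private
    w₁ w₂ : Fin N
    w₁ = proj₁ (Bijection.strictlySurjective f fzero)
    w₂ = proj₁ (Bijection.strictlySurjective f (fsuc fzero))

    label₁-odd : even? (label f w₁) ≡ false
    label₁-odd = cong (even? ∘ suc ∘ toℕ) (proj₂ (Bijection.strictlySurjective f fzero))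

    label₂-even : even? (label f w₂) ≡ true
    label₂-even = cong (even? ∘ suc ∘ toℕ) (proj₂ (Bijection.strictlySurjective f (fsuc fzero)))

  nonconstant : ∃ λ k → k < N × parity k ≢ parity 0
  nonconstant with parity (toℕ w₁) Bool.≟ parity 0
  ... | no  p₁≢p₀ = toℕ w₁ , toℕ<n w₁ , p₁≢p₀
  ... | yes p₁≡p₀ = toℕ w₂ , toℕ<n w₂ , λ p₂≡p₀ → true≢false (begin
      true                ≡⟨ sym label₂-even ⟩
      even? (label f w₂)  ≡⟨ sym (parity-toℕ w₂) ⟩
      parity (toℕ w₂)     ≡⟨ trans p₂≡p₀ (sym p₁≡p₀) ⟩
      parity (toℕ w₁)     ≡⟨ parity-toℕ w₁ ⟩
      even? (label f w₁)  ≡⟨ label₁-odd ⟩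
      false               ∎)
    where
    open ≡-Reasoning
    true≢false : true ≢ false
    true≢false ()

  step-edge : ℕ → Fin N × Fin N
  step-edge i = (i mod N , suc i mod N)

  wrap-edge : ℕ → Fin N × Fin N
  wrap-edge j = (0 mod N , j mod N)

  step-edge-negative : ∀ {i} → suc i < N → Change parity i → step-edge i ∈ negativeEdgeList (C N) f
  step-edge-negative {i} 1+i<N change = ∈-negativeEdgeList⁺ (C N) f (∈-C-step 1+i≡1+i) change
    where
    1+i≡1+i : toℕ (suc i mod N) ≡ suc (toℕ (i mod N))
    1+i≡1+i = trans (toℕ-mod 1+i<N) (cong suc (sym (toℕ-mod (<-trans (n<1+n i) 1+i<N))))

  wrap-edge-negative : ∀ {j} → suc j ≡ N → Change parity j → wrap-edge j ∈ negativeEdgeList (C N) f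
  wrap-edge-negative {j} 1+j≡N change =
    ∈-negativeEdgeList⁺ (C N) f (∈-C-wrap 0<j refl (trans (cong suc j≡j) 1+j≡N)) λ p₀≡pⱼ →
      change (trans (sym p₀≡pⱼ) (trans (sym parity-N) (cong parity (sym 1+j≡N))))
    where
    j≡j : toℕ (j mod N) ≡ j
    j≡j = toℕ-mod (subst (j <_) 1+j≡N ≤-refl)
    0<j : 0 < toℕ (j mod N)
    0<j = subst (0 <_) (sym (trans j≡j (suc-injective 1+j≡N))) (s≤s z≤n)

  step-edges-distinct : ∀ {i j} → i < j → j < N → step-edge i ≢ step-edge j
  step-edges-distinct {i} {j} i<j j<N eq = <⇒≢ i<j (begin
    i                   ≡⟨ sym (toℕ-mod (<-trans i<j j<N)) ⟩
    toℕ (i mod N)       ≡⟨ cong (toℕ ∘ proj₁) eq ⟩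
    toℕ (j mod N)       ≡⟨ toℕ-mod j<N ⟩
    j                   ∎)
    where open ≡-Reasoning

  -- The one place where n ≥ 3 is used: in C₂ the step edge 0–1 is also the wrap edge.
  step≢wrap-edge : ∀ {i j} → suc i < N → suc j ≡ N → step-edge i ≢ wrap-edge j
  step≢wrap-edge {i} {j} 1+i<N 1+j≡N eq = 3+m≢2 (begin
    3 + m                   ≡⟨ sym 1+j≡N ⟩
    suc j                   ≡⟨ cong suc (sym (toℕ-mod (subst (j <_) 1+j≡N ≤-refl))) ⟩
    suc (toℕ (j mod N))     ≡⟨ cong (suc ∘ toℕ ∘ proj₂) eq ⟨
    suc (toℕ (suc i mod N)) ≡⟨ cong suc (toℕ-mod 1+i<N) ⟩
    suc (suc i)             ≡⟨ cong (suc ∘ suc) i≡0 ⟩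
    2                       ∎)
    where
    open ≡-Reasoning
    i≡0 : i ≡ 0
    i≡0 = trans (sym (toℕ-mod (<-trans (n<1+n i) 1+i<N))) (cong (toℕ ∘ proj₁) eq)
    3+m≢2 : 3 + m ≢ 2
    3+m≢2 ()

  lowerBound : 2 ≤ negativeEdges (C N) f
  lowerBound with nonconstant
  ... | k , k<N , pₖ≢p₀ with two-changes parity k<N pₖ≢p₀ parity-N
  ...   | i , j , i<k , k≤j , j<N , changeᵢ , changeⱼ with suc j <? N
  ...     | yes 1+j<N = 2≤length (step-edge-negative (≤-<-trans i<k k<N) changeᵢ) (step-edge-negative 1+j<N changeⱼ)
                          (step-edges-distinct (<-≤-trans i<k k≤j) j<N)
  ...     | no  1+j≮N = 2≤length (step-edge-negative (≤-<-trans i<k k<N) changeᵢ) (wrap-edge-negative 1+j≡N changeⱼ)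
                          (step≢wrap-edge (≤-<-trans i<k k<N) 1+j≡N)
    where
    1+j≡N : suc j ≡ N
    1+j≡N = ≤-antisym j<N (≮⇒≥ 1+j≮N)

even?-double : ∀ t → even? (t + t) ≡ true
even?-double zero    = refl
even?-double (suc t) rewrite +-suc t t = trans (not-involutive (even? (t + t))) (even?-double t)

even-or-odd : ∀ n → (∃ λ t → n ≡ t + t) ⊎ (∃ λ t → n ≡ suc (t + t))
even-or-odd zero = inj₁ (0 , refl)
even-or-odd (suc n) with even-or-odd n
... | inj₁ (t , n≡2t)   = inj₂ (t , cong suc n≡2t)
... | inj₂ (t , n≡1+2t) = inj₁ (suc t , cong suc (trans n≡1+2t (sym (+-suc t t))))

ceiling-half : ∀ n → ∃ λ c → n ≤ c + c × c + c ≤ suc n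
ceiling-half n with even-or-odd n
... | inj₁ (t , refl) = t , ≤-refl , n≤1+n (t + t)
... | inj₂ (t , refl) = suc t , s≤s (+-monoʳ-≤ t (n≤1+n t)) , ≤-reflexive (cong suc (+-suc t t))

m+m≡n+n⇒m≡n : ∀ {m n} → m + m ≡ n + n → m ≡ n
m+m≡n+n⇒m≡n {m} {n} eq = trans (n≡⌊n+n/2⌋ m) (trans (cong ⌊_/2⌋ eq) (sym (n≡⌊n+n/2⌋ n)))

m+m≢1+n+n : ∀ {m n} → m + m ≢ suc (n + n)
m+m≢1+n+n {m} {n} eq with trans (sym (even?-double m)) (trans (cong even? eq) (cong not (even?-double n)))
... | ()

m+m<n+n⇒m<n : ∀ {m n} → m + m < n + n → m < n
m+m<n+n⇒m<n m+m<n+n = ≰⇒> (λ n≤m → <⇒≱ m+m<n+n (+-mono-≤ n≤m n≤m))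

m+n≤o≤n+n⇒m+m≤o : ∀ {m n o} → m + n ≤ o → o ≤ n + n → m + m ≤ o
m+n≤o≤n+n⇒m+m≤o {m} {n} {o} m+n≤o o≤n+n = ≮⇒≥ λ o<m+m →
  let n<m = +-cancelˡ-< m n m (≤-<-trans m+n≤o o<m+m)
  in  <⇒≱ (≤-<-trans o≤n+n (+-monoˡ-< n n<m)) m+n≤o

module UpperBound (m c : ℕ) (1+m≤c+c : suc m ≤ c + c) (c+c≤2+m : c + c ≤ suc (suc m)) where

  private
    N : ℕ
    N = suc m

  interleave : ℕ → ℕ
  interleave x with x <? c
  ... | yes _ = x + x
  ... | no  _ = suc ((x ∸ c) + (x ∸ c))

  interleave-low : ∀ {x} → x < c → interleave x ≡ x + x
  interleave-low {x} x<c with x <? c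
  ... | yes _   = refl
  ... | no  x≮c = ⊥-elim (x≮c x<c)

  interleave-high : ∀ {x} → c ≤ x → interleave x ≡ suc ((x ∸ c) + (x ∸ c))
  interleave-high {x} c≤x with x <? c
  ... | yes x<c = ⊥-elim (<⇒≱ x<c c≤x)
  ... | no  _   = refl

  interleave-< : ∀ {x} → x < N → interleave x < N
  interleave-< {x} x<N with x <? c
  ... | yes x<c = ≤-pred (begin
    suc (suc (x + x)) ≡⟨ cong suc (+-suc x x) ⟨
    suc x + suc x     ≤⟨ +-mono-≤ x<c x<c ⟩
    c + c             ≤⟨ c+c≤2+m ⟩
    suc N             ∎)
    where open ≤-Reasoning
  ... | no  x≮c = subst (_≤ N) (cong suc (+-suc d d)) (m+n≤o≤n+n⇒m+m≤o {suc d} {c} 1+d+c≤N 1+m≤c+c)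
    where
    d : ℕ
    d = x ∸ c
    1+d+c≤N : suc d + c ≤ N
    1+d+c≤N = subst (λ y → suc y ≤ N) (sym (m∸n+n≡m (≮⇒≥ x≮c))) x<N

  interleave-injective : ∀ {x y} → interleave x ≡ interleave y → x ≡ y
  interleave-injective {x} {y} eq with x <? c | y <? c
  ... | yes _   | yes _   = m+m≡n+n⇒m≡n eq
  ... | yes _   | no  _   = ⊥-elim (m+m≢1+n+n {x} {y ∸ c} eq)
  ... | no  _   | yes _   = ⊥-elim (m+m≢1+n+n {y} {x ∸ c} (sym eq))
  ... | no  x≮c | no  y≮c = begin
    x           ≡⟨ m∸n+n≡m (≮⇒≥ x≮c) ⟨
    x ∸ c + c   ≡⟨ cong (_+ c) (m+m≡n+n⇒m≡n (suc-injective eq)) ⟩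
    y ∸ c + c   ≡⟨ m∸n+n≡m (≮⇒≥ y≮c) ⟩
    y           ∎
    where open ≡-Reasoning

  interleave-surjective : ∀ {y} → y < N → ∃ λ x → x < N × interleave x ≡ y
  interleave-surjective {y} y<N with even-or-odd y
  ... | inj₁ (t , refl) = t , ≤-<-trans (m≤m+n t t) y<N , interleave-low t<c
    where
    t<c : t < c
    t<c = m+m<n+n⇒m<n (<-≤-trans y<N 1+m≤c+c)
  ... | inj₂ (t , refl) =
    c + t , c+t<N , trans (interleave-high (m≤m+n c t)) (cong (λ d → suc (d + d)) (m+n∸m≡n c t))
    where
    c+t<N : c + t < N
    c+t<N = m+m<n+n⇒m<n (begin-strict
      (c + t) + (c + t)   ≡⟨ interchange c t c t ⟩
      (c + c) + (t + t)   ≤⟨ +-monoˡ-≤ (t + t) c+c≤2+m ⟩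
      suc N + (t + t)     ≡⟨ +-suc N (t + t) ⟨
      N + suc (t + t)     <⟨ +-monoʳ-< N y<N ⟩
      N + N               ∎)
      where open ≤-Reasoning

  even?-1+interleave-low : ∀ {x} → x < c → even? (suc (interleave x)) ≡ false
  even?-1+interleave-low {x} x<c rewrite interleave-low x<c = cong not (even?-double x)

  even?-1+interleave-high : ∀ {x} → c ≤ x → even? (suc (interleave x)) ≡ true
  even?-1+interleave-high {x} c≤x rewrite interleave-high c≤x =
    trans (not-involutive (even? (x ∸ c + (x ∸ c)))) (even?-double (x ∸ c))

  interleaveFin : Fin N → Fin N
  interleaveFin v = fromℕ< (interleave-< (toℕ<n v))

  toℕ-interleaveFin : ∀ v → toℕ (interleaveFin v) ≡ interleave (toℕ v)
  toℕ-interleaveFin v = toℕ-fromℕ< (interleave-< (toℕ<n v))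

  interleaving : Fin N ⤖ Fin N
  interleaving = mk⤖ {to = interleaveFin} (injective , strictlySurjective⇒surjective surjective)
    where
    injective : ∀ {u v} → interleaveFin u ≡ interleaveFin v → u ≡ v
    injective {u} {v} eq = toℕ-injective (interleave-injective (begin
      interleave (toℕ u)      ≡⟨ toℕ-interleaveFin u ⟨
      toℕ (interleaveFin u)   ≡⟨ cong toℕ eq ⟩
      toℕ (interleaveFin v)   ≡⟨ toℕ-interleaveFin v ⟩
      interleave (toℕ v)      ∎))
      where open ≡-Reasoning
    surjective : ∀ w → ∃ λ v → interleaveFin v ≡ w
    surjective w =
      let x , x<N , eq = interleave-surjective (toℕ<n w)
      in  fromℕ< x<N , toℕ-injective (trans (toℕ-interleaveFin _) (trans (cong interleave (toℕ-fromℕ< x<N)) eq))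

  label-low : ∀ {v} → toℕ v < c → even? (label interleaving v) ≡ false
  label-low {v} v<c = trans (cong (even? ∘ suc) (toℕ-interleaveFin v)) (even?-1+interleave-low v<c)

  label-high : ∀ {v} → c ≤ toℕ v → even? (label interleaving v) ≡ true
  label-high {v} c≤v = trans (cong (even? ∘ suc) (toℕ-interleaveFin v)) (even?-1+interleave-high c≤v)

  opposite⇒straddle : ∀ {u v} → toℕ u ≤ toℕ v → OppositeParity interleaving u v → toℕ u < c × c ≤ toℕ v
  opposite⇒straddle {u} {v} u≤v opposite with c ≤? toℕ u | c ≤? toℕ v
  ... | no  c≰u | yes c≤v = ≰⇒> c≰u , c≤v
  ... | no  c≰u | no  c≰v = ⊥-elim (opposite (trans (label-low (≰⇒> c≰u)) (sym (label-low (≰⇒> c≰v)))))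
  ... | yes c≤u | _       = ⊥-elim (opposite (trans (label-high c≤u) (sym (label-high (≤-trans c≤u u≤v)))))

  negative⇒boundary : ∀ {e} → e ∈ negativeEdgeList (C N) interleaving → Ends (c ∸ 1) c e ⊎ Ends 0 m e
  negative⇒boundary {u , v} negative with ∈-negativeEdgeList⁻ (C N) interleaving negative
  ... | edge , opposite with ∈-C⁻ edge
  ...   | inj₂ (u≡0 , 1+v≡N) = inj₂ (u≡0 , suc-injective 1+v≡N)
  ...   | inj₁ v≡1+u =
    let u<c , c≤v = opposite⇒straddle (subst (toℕ u ≤_) (sym v≡1+u) (n≤1+n (toℕ u))) opposite
        1+u≡c     = ≤-antisym u<c (subst (c ≤_) v≡1+u c≤v)
    in  inj₁ (cong (_∸ 1) 1+u≡c , trans v≡1+u 1+u≡c)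

  upperBound : negativeEdges (C N) interleaving ≤ 2
  upperBound = length≤2 Ends-unique Ends-unique (negativeEdgeList-unique (C N) interleaving) (All.tabulate negative⇒boundary)

mainTheorem5 : (n : ℕ) → n ≥ 3 → IsRna (C n) 2
mainTheorem5 (suc (suc (suc m))) _ =
  let c , 3+m≤c+c , c+c≤4+m = ceiling-half (3 + m)
      open UpperBound (2 + m) c 3+m≤c+c c+c≤4+m
  in  (interleaving , ≤-antisym upperBound (LowerBound.lowerBound m interleaving)) , LowerBound.lowerBound m
mainTheorem5 1 (s≤s ())
mainTheorem5 2 (s≤s (s≤s ()))
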